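{- Let $P$ be a Horn mca-program and let $M \subseteq \mathit{At}$ be a model of $P$. Define $X_0 = \emptyset$ and, for every $n \geq 0$, $X_{n+1} = \mathit{hset}(P(X_n)) \cap M$. Then the sequence $(X_n)_{n=0,1,\ldots}$ is a $P$-computation.
   Context: Let $\mathit{At}$ be a set of propositional atoms. An mc-atom over $\mathit{At}$ is an expression $kX$, where $k$ is a non-negative integer and $X \subseteq \mathit{At}$ is finite with $k \leq |X|$; $\mathit{aset}(kX) = X$. An mc-literal is $A$ or $\mathbf{not}(A)$ for an mc-atom $A$. An mca-clause $r$ is an expression $H \leftarrow L_1, \ldots, L_m$ ($m \geq 0$), where $H$ is an mc-atom and the $L_i$ are mc-literals, with $\mathit{hd}(r) = H$, $\mathit{bd}(r) = \{L_1, \ldots, L_m\}$, and $\mathit{hset}(r) = \mathit{aset}(H)$. An mca-program is a set of mca-clauses. It is Horn if no clause body contains a literal of the form $\mathbf{not}(A)$. For a set $Q$ of clauses, $\mathit{hset}(Q) = \bigcup\{\mathit{hset}(r) : r \in Q\}$. Satisfaction, for $M \subseteq \mathit{At}$: - $M \models kX$ iff $|M \cap X| \geq k$. - $M \models \mathbf{not}(kX)$ iff $|M \cap X| < k$. - $M \models \mathit{bd}(r)$ iff $M$ satisfies all literals of $\mathit{bd}(r)$. - $M$ satisfies $r$ if $M \models \mathit{hd}(r)$ whenever $M \models \mathit{bd}(r)$. - $M$ is a model of $P$ if it satisfies all clauses of $P$. Operators: - $P(M) = \{r \in P : M \models \mathit{bd}(r)\}$. - $T^{\mathit{nd}}_P(M)$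 is the set of all $M'$ with $M' \subseteq \mathit{hset}(P(M))$ and $M' \models \mathit{hd}(r)$ for all $r \in P(M)$. A $P$-computation (for Horn $P$) is a sequence $(X_n)_{n \geq 0}$ with $X_0 = \emptyset$ and, for every $n$, $X_n \subseteq X_{n+1}$ and $X_{n+1} \in T^{\mathit{nd}}_P(X_n)$. -}

module Defs where

open import Data.Nat using (ℕ; zero; suc)
open import Data.List using (List; length)
open import Data.List.Membership.Propositional using (_∈_)
open import Data.List.Relation.Unary.All using (All)
open import Data.List.Relation.Unary.Unique.Propositional using (Unique)
open import Data.Product using (Σ; ∃; _×_)
open import Data.Unit using (⊤)
open import Data.Empty using (⊥)
open import Relation.Nullary using (¬_)
open import Relation.Binary.PropositionalEquality using (_≡_)

-- Finite sets X ⊆ At are given by lists (duplicates are harmless: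
-- all counting below counts *distinct* elements).
module MCA (At : Set) where

  AtomSet : Set₁
  AtomSet = At → Set

  _⊆_ : AtomSet → AtomSet → Set
  A ⊆ B = ∀ a → A a → B a

  -- |M ∩ X| ≥ k : there are k distinct atoms lying in both X and M.
  AtLeast : ℕ → AtomSet → List At → Set
  AtLeast k M X = Σ (List At) λ ys →
    length ys ≡ k × Unique ys × All (λ a → a ∈ X × M a) ys

  -- mc-atom kX with k ≤ |X|
  record MCAtom : Set where
    constructor mc
    field
      k     : ℕ
      X     : List At
      bound : AtLeast k (λ _ → ⊤) X

  aset : MCAtom → List At
  aset = MCAtom.X

  data MCLit : Set where
    pos : MCAtom → MCLit
    neg : MCAtom → MCLit

  record Clause : Set where
    constructor _⟵_
    field
      hd : MCAtom
      bd : List MCLit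

  open Clause public

  hsetᶜ : Clause → List At
  hsetᶜ r = aset (hd r)

  Program : Set₁
  Program = Clause → Set

  IsPos : MCLit → Set
  IsPos (pos _) = ⊤
  IsPos (neg _) = ⊥

  Horn : Program → Set
  Horn P = ∀ r → P r → All IsPos (bd r)

  _⊨_ : AtomSet → MCAtom → Set
  M ⊨ A = AtLeast (MCAtom.k A) M (MCAtom.X A)

  _⊨ˡ_ : AtomSet → MCLit → Set
  M ⊨ˡ pos A = M ⊨ A
  M ⊨ˡ neg A = ¬ (M ⊨ A)

  _⊨bd_ : AtomSet → Clause → Set
  M ⊨bd r = All (M ⊨ˡ_) (bd r)

  Satisfies : AtomSet → Clause → Set
  Satisfies M r = M ⊨bd r → M ⊨ hd r

  Model : AtomSet → Program → Set
  Model M P = ∀ r → P r → Satisfies M r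

  Applicable : Program → AtomSet → Program
  Applicable P M r = P r × M ⊨bd r

  hset : Program → AtomSet
  hset Q a = ∃ λ r → Q r × a ∈ hsetᶜ r

  Tnd : Program → AtomSet → AtomSet → Set
  Tnd P M M' = (M' ⊆ hset (Applicable P M))
             × (∀ r → Applicable P M r → M' ⊨ hd r)

  Computation : Program → (ℕ → AtomSet) → Set
  Computation P X =
      (∀ a → ¬ X 0 a)
    × (∀ n → X n ⊆ X (suc n))
    × (∀ n → Tnd P (X n) (X (suc n)))

  canonSeq : Program → AtomSet → ℕ → AtomSet
  canonSeq P M zero    a = ⊥
  canonSeq P M (suc n) a = hset (Applicable P (canonSeq P M n)) a × M a

{-# OPTIONS --safe #-}
module Submission where

open import Defs
open import Data.Nat using (suc)
open import Data.List using ([]; _∷_)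
open import Data.List.Membership.Propositional using (_∈_)
open import Data.List.Relation.Unary.All as All using (All; []; _∷_)
open import Data.Product using (_×_; _,_; proj₁)

-- For Horn programs applicability is monotone in the interpretation, which makes the
-- sequence increasing.  Each clause applicable at X_n has its head satisfied by M, and
-- the atoms witnessing this lie in hset(P(X_n)) ∩ M = X_{n+1}.
module _ {At : Set} where
  open MCA At

  _∩_ : AtomSet → AtomSet → AtomSet
  (A ∩ B) a = A a × B a

  AtLeast-mono-within : ∀ {A B : AtomSet} {k X} → (∀ a → a ∈ X → A a → B a) →
                        AtLeast k A X → AtLeast k B X
  AtLeast-mono-within A⊆B (ys , |ys| , unique , inside) =
    ys , |ys| , unique , All.map (λ { {a} (a∈X , Aa) → a∈X , A⊆B a a∈X Aa }) inside

  ⊨-mono : ∀ {A B : AtomSet} {H} → A ⊆ B → A ⊨ H → B ⊨ H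
  ⊨-mono A⊆B = AtLeast-mono-within (λ a _ → A⊆B a)

  positive-⊨ˡ-mono : ∀ {A B : AtomSet} {ls} → All IsPos ls → A ⊆ B →
                     All (A ⊨ˡ_) ls → All (B ⊨ˡ_) ls
  positive-⊨ˡ-mono {ls = []}        []       _   []       = []
  positive-⊨ˡ-mono {ls = pos H ∷ _} (_ ∷ ps) A⊆B (h ∷ hs) =
    ⊨-mono {H = H} A⊆B h ∷ positive-⊨ˡ-mono ps A⊆B hs

  hset-Applicable-mono : ∀ {P} {A B : AtomSet} → Horn P → A ⊆ B →
                         hset (Applicable P A) ⊆ hset (Applicable P B)
  hset-Applicable-mono horn A⊆B a (r , (r∈P , A⊨bd) , a∈hd) =
    r , (r∈P , positive-⊨ˡ-mono (horn r r∈P) A⊆B A⊨bd) , a∈hd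

  model-∩-hset-∈-Tnd : ∀ {P M N} → Horn P → Model M P → N ⊆ M →
                       Tnd P N (hset (Applicable P N) ∩ M)
  model-∩-hset-∈-Tnd {P} {M} {N} horn model N⊆M = (λ _ → proj₁) , satisfies-head
    where
    satisfies-head : ∀ r → Applicable P N r → (hset (Applicable P N) ∩ M) ⊨ hd r
    satisfies-head r r∈P[N]@(r∈P , N⊨bd) =
      AtLeast-mono-within (λ a a∈hd Ma → (r , r∈P[N] , a∈hd) , Ma)
        (model r r∈P (positive-⊨ˡ-mono (horn r r∈P) N⊆M N⊨bd))

  canonSeq-⊆ : ∀ P M n → canonSeq P M n ⊆ M
  canonSeq-⊆ P M (suc n) a (_ , Ma) = Ma

  canonSeq-increasing : ∀ P M → Horn P → ∀ n → canonSeq P M n ⊆ canonSeq P M (suc n)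
  canonSeq-increasing P M horn (suc n) a (a∈hset , Ma) =
    hset-Applicable-mono horn (canonSeq-increasing P M horn n) a a∈hset , Ma

theorem2 : (At : Set) → let open MCA At in
    (P : Program) → Horn P → (M : AtomSet) → Model M P →
    Computation P (canonSeq P M)
theorem2 At P horn M model =
    (λ _ ())
  , canonSeq-increasing P M horn
  , λ n → model-∩-hset-∈-Tnd horn model (canonSeq-⊆ P M n)
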